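{- Let $u\le w$ in $\mathbb{P}^*$, order the maximal chains of $[u,w]$ lexicographically by label sequence, and let $C$ be a maximal chain of $[u,w]$ that is weakly decreasing and ends at an embedding $\eta_u$ of $u$ into $w$ which is not normal. Then $C$ is not critical.
   Context: $\mathbb{P}^*$: finite words over the positive integers, $u\le w$ iff $w$ has a subword $w(i_1)\cdots w(i_l)$ ($i_1<\dots<i_l$, $l=|u|$) with $u(j)\le w(i_j)$. Covers: $y$ is obtained from $x$ by decreasing one entry by $1$ (deleting it if it becomes $0$). An expansion of $u$ is a word over nonnegative integers whose restriction to its nonzero positions is $u$; an embedding of $u$ into $w$ is an expansion $\eta_u$ of length $|w|$ with $\eta_u(i)\le w(i)$ for all $i$. A run of $k$'s in $w$ is a maximal index interval $[r,t]$ with $w(r)=\dots=w(t)=k$. An embedding $\eta_u$ is normal if $\eta_u(i)\in\{w(i),w(i)-1,0\}$ for all $i$, and for every run $[r,t]$ of $k$'s in $w$: if $k=1$ then $\eta_u(i)\ne0$ for $r<i\le t$; if $k\ge2$ then $\eta_u(r)\neq 0$. Labels: for a maximal chain $C: w=v_0\gtrdot\cdots\gtrdot v_d=u$ set $\eta_{v_0}=w$; for $j\ge1$, $\eta_{v_j}$ is the expansion of $v_j$ obtained from $\eta_{v_{j-1}}$ by subtracting $1$ at a single position $i$, where, if that entry goes from $1$ to $0$, $i$ is the position of the leftmost $1$ of the run of $1$'s of $v_{j-1}$ containing the deleted entry; the label is $l_j=i$, and $C$ ends at $\eta_{v_d}$. $C$ is weakly decreasing if $l_1\ge\cdots\ge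 l_d$. Chains are ordered lexicographically by label sequence. For $0\le i<j\le d$, $j-i\ge2$, $C(v_i,v_j)=\{v_{i+1},\dots,v_{j-1}\}$; it is skipped if $C\setminus C(v_i,v_j)\subseteq C'$ for some maximal chain $C'<C$; an MSI is a skipped interval strictly containing no other skipped interval. $\mathcal{I}(C)$: MSIs listed $I_1,I_2,\dots$ by position along $C$. $\mathcal{J}(C)$: $J_1=I_1$; given $J_1,\dots,J_s$, replace the remaining $I_k$ by $I_k\setminus(J_1\cup\dots\cup J_s)$, discard empty ones and those strictly containing another modified set, and let $J_{s+1}$ be the first remaining; stop when none remain. $C$ is critical if $\bigcup\mathcal{J}(C)=\{v_1,\dots,v_{d-1}\}$. -}

module Defs where

open import Data.Nat using (ℕ; zero; suc; _≤_; _<_; _<ᵇ_; pred)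
open import Data.Bool using (Bool; _∧_)
open import Data.List using (List; []; _∷_; length; filter; map; foldr)
open import Data.List.Relation.Unary.All using (All)
open import Data.List.Relation.Unary.Any using (any?)
open import Data.List.Relation.Unary.Linked using (Linked)
open import Data.List.Membership.Propositional using () renaming (_∈_ to _∈ₗ_)
open import Data.Product using (Σ; ∃; _×_; _,_; proj₁; proj₂)
open import Data.Sum using (_⊎_)
open import Data.Fin using (Fin; toℕ)
open import Data.Fin.Subset using (Subset; _─_; _∪_; _⊂_; Nonempty) renaming (⊥ to ∅)
open import Data.Fin.Subset.Properties using (nonempty?; _⊂?_)
open import Data.Vec using (tabulate)
open import Relation.Nullary using (¬_; ¬?)
open import Relation.Binary.PropositionalEquality using (_≡_; _≢_)

-- Words.  A word is a list of naturals; words of ℙ* are those whose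
-- entries are all positive.  Positions are 0-based (the paper is
-- 1-based; only the order of positions matters).

Word : Set
Word = List ℕ

Positive : Word → Set
Positive = All (λ x → 1 ≤ x)

-- entry at a position (0 outside the word)
at : List ℕ → ℕ → ℕ
at []       _       = 0
at (x ∷ xs) zero    = x
at (x ∷ xs) (suc i) = at xs i

-- the order of ℙ*: u ≤ w iff w has a subword w(i₁)⋯w(iₗ), l = |u|,
-- with u(j) ≤ w(iⱼ)  (inductive rendering of the subword condition)
infix 4 _≼_
data _≼_ : Word → Word → Set where
  nil  : ∀ {w} → [] ≼ w
  skip : ∀ {u x w} → u ≼ w → u ≼ (x ∷ w)
  take : ∀ {a u x w} → a ≤ x → u ≼ w → (a ∷ u) ≼ (x ∷ w)

decDel : ℕ → Word → Word
decDel _       []                 = []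
decDel zero    (zero ∷ xs)        = zero ∷ xs
decDel zero    (suc zero ∷ xs)    = xs
decDel zero    (suc (suc n) ∷ xs) = suc n ∷ xs
decDel (suc i) (x ∷ xs)           = x ∷ decDel i xs

Covers : Word → Word → Set
Covers x y = Σ ℕ λ i → i < length x × y ≡ decDel i x

nz : List ℕ → Word
nz []          = []
nz (zero ∷ xs) = nz xs
nz (suc n ∷ xs) = suc n ∷ nz xs

IsEmbedding : Word → Word → List ℕ → Set
IsEmbedding u w η =
  nz η ≡ u × length η ≡ length w × (∀ i → at η i ≤ at w i)

Run : Word → ℕ → ℕ → ℕ → Set
Run w k r t =
  r ≤ t × t < length w × (∀ i → r ≤ i → i ≤ t → at w i ≡ k)
  × (r ≡ 0 ⊎ at w (pred r) ≢ k) × (suc t ≡ length w ⊎ at w (suc t) ≢ k)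

Normal : Word → List ℕ → Set
Normal w η =
  (∀ i → i < length w → (at η i ≡ at w i ⊎ at η i ≡ pred (at w i) ⊎ at η i ≡ 0))
  × (∀ k r t → Run w k r t →
       (k ≡ 1 → ∀ i → r < i → i ≤ t → at η i ≢ 0)
     × (2 ≤ k → at η r ≢ 0))

decAt : ℕ → List ℕ → List ℕ
decAt _       []       = []
decAt zero    (x ∷ xs) = pred x ∷ xs
decAt (suc i) (x ∷ xs) = x ∷ decAt i xs

-- position i (holding a 1 in the expansion η) is the leftmost 1 of its run
-- of 1's in the word nz η: every earlier 1 is separated from i by some
-- nonzero entry.
LeftmostOne : List ℕ → ℕ → Set
LeftmostOne η i =
  ∀ k → k < i → at η k ≡ 1 → Σ ℕ λ m → k < m × m < i × at η m ≢ 0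

-- one labelled step: from the expansion η (of v_{j-1}) subtract 1 at
-- position i, obtaining the expansion η' of v (= v_j); label i.
LabelStep : List ℕ → Word → ℕ → List ℕ → Set
LabelStep η v i η' =
  1 ≤ at η i × η' ≡ decAt i η × nz η' ≡ v × (at η i ≡ 1 → LeftmostOne η i)

-- Maximal chains of [u,w]:  w = v 0 ⋗ v 1 ⋗ ⋯ ⋗ v len = u,
-- with expansions η 0 = w, …, η len and labels;  lab j is the label
-- l_{j+1} of the step v j ⋗ v (j+1)  (0-based indexing of labels).

record MaxChain (u w : Word) : Set where
  field
    len    : ℕ
    v      : ℕ → Word
    η      : ℕ → List ℕ
    lab    : ℕ → ℕ
    v-top  : v 0 ≡ w
    v-bot  : v len ≡ u
    covers : ∀ j → j < len → Covers (v j) (v (suc j))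
    η-top  : η 0 ≡ w
    steps  : ∀ j → j < len → LabelStep (η j) (v (suc j)) (lab j) (η (suc j))
open MaxChain public

endsAt : ∀ {u w} → MaxChain u w → List ℕ
endsAt C = η C (len C)

WeaklyDecreasing : ∀ {u w} → MaxChain u w → Set
WeaklyDecreasing C = ∀ j → suc j < len C → lab C (suc j) ≤ lab C j

_<ₗₑₓ_ : ∀ {u w} → MaxChain u w → MaxChain u w → Set
C' <ₗₑₓ C = Σ ℕ λ m → (∀ k → k < m → lab C' k ≡ lab C k)
  × ((m < len C' × m < len C × lab C' m < lab C m) ⊎ (m ≡ len C' × m < len C))

_∈C_ : ∀ {u w} → Word → MaxChain u w → Set
x ∈C C = Σ ℕ λ k → k ≤ len C × v C k ≡ x

Skipped : ∀ {u w} → MaxChain u w → ℕ → ℕ → Set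
Skipped {u} {w} C i j =
  suc (suc i) ≤ j × j ≤ len C ×
  Σ (MaxChain u w) λ C' → C' <ₗₑₓ C ×
    (∀ k → k ≤ len C → (k ≤ i ⊎ j ≤ k) → v C k ∈C C')

-- minimal skipped interval (chain elements are distinct, so containment
-- of C(v_i,v_j) ⊇ C(v_i',v_j') is i ≤ i' and j' ≤ j)
MSI : ∀ {u w} → MaxChain u w → ℕ → ℕ → Set
MSI C i j = Skipped C i j ×
  (∀ i' j' → Skipped C i' j' → i ≤ i' → j' ≤ j → i ≡ i' × j ≡ j')

IsMSIList : ∀ {u w} → MaxChain u w → List (ℕ × ℕ) → Set
IsMSIList C ps =
  Linked (λ p q → proj₁ p < proj₁ q) ps × All (λ p → MSI C (proj₁ p) (proj₂ p)) ps
  × (∀ i j → MSI C i j → (i , j) ∈ₗ ps)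

-- index sets: subsets of {0,…,len}
-- C(v_i,v_j) as the set of indices {i+1,…,j-1}
interval : ∀ {n} → ℕ → ℕ → Subset n
interval i j = tabulate λ k → (i <ᵇ toℕ k) ∧ (toℕ k <ᵇ j)

prune : ∀ {n} → Subset n → List (Subset n) → List (Subset n)
prune U L =
  let M = filter nonempty? (map (λ I → I ─ U) L)
  in filter (λ A → ¬? (any? (λ B → B ⊂? A) M)) M

-- JRun U L Js : starting with union-so-far U and remaining sets L,
-- the procedure produces J's Js
data JRun {n : ℕ} : Subset n → List (Subset n) → List (Subset n) → Set where
  stop : ∀ {U L} → prune U L ≡ [] → JRun U L []
  next : ∀ {U L J L' Js} → prune U L ≡ J ∷ L' → JRun (U ∪ J) L' Js
       → JRun U L (J ∷ Js)

data JSeq {n : ℕ} : List (Subset n) → List (Subset n) → Set where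
  none  : JSeq [] []
  first : ∀ {I₁ Is Js} → JRun I₁ Is Js → JSeq (I₁ ∷ Is) (I₁ ∷ Js)

Critical : ∀ {u w} → MaxChain u w → Set
Critical C =
  Σ (List (ℕ × ℕ)) λ ps → IsMSIList C ps ×
  Σ (List (Subset (suc (len C)))) λ Js →
    JSeq (map (λ p → interval (proj₁ p) (proj₂ p)) ps) Js
    × foldr _∪_ ∅ Js ≡ interval 0 (len C)

{-# OPTIONS --safe #-}
-- Suppose C is critical and its end η = endsAt C is not normal at position p.
-- A zero of η strictly inside a run of 1's of w is impossible for any weakly
-- decreasing chain: the step deleting that 1 would not act on the leftmost 1
-- of its run.  Otherwise η(p) ≤ w(p) − 2, and η(p) ≥ 1 or p starts a run of w.
-- Let s be the first step labelled p.  Weak decrease forces step s + 1 to be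
-- labelled p too, and criticality puts v_(s+1) in an MSI, which turns out to
-- be C(v_s, v_j) with all its steps labelled p.  Comparing weights left of p
-- along a lexicographically smaller chain skipping it shows that the block
-- empties position p and that w(p − 1) = w(p), refuting both alternatives.

module Submission where

open import Defs
open import Data.Nat
  using (ℕ; zero; suc; _+_; _∸_; _≤_; _<_; pred; z≤n; s≤s; s≤s⁻¹; z<s; >-nonZero; _≟_; _<?_; _≤?_)
open import Data.Nat.Properties
open import Data.Nat.ListAction using (sum)
open import Data.Nat.ListAction.Properties using (sum-++)
open import Data.Bool.Properties using (T-≡; T-∧)
open import Data.List as List using (List; []; _∷_; _++_; [_]; length)
open import Data.List.Properties
  using (++-assoc; length-++; length-++-≤ʳ; length-take; ∷-injectiveʳ; ∷ʳ-injectiveˡ)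
open import Data.List.Relation.Unary.All as All using (All; []; _∷_)
open import Data.List.Relation.Unary.All.Properties using (filter⁺; map⁺)
open import Data.List.Relation.Unary.Any using (here; there)
open import Data.List.Membership.Propositional using () renaming (_∈_ to _∈ₗ_)
open import Data.List.Membership.Propositional.Properties using (∈-map⁻)
open import Data.Product using (∃; ∃₂; _×_; _,_; proj₁; proj₂)
open import Data.Sum using (_⊎_; inj₁; inj₂; map₂)
open import Data.Empty using (⊥; ⊥-elim)
open import Data.Fin using (Fin; toℕ; fromℕ<)
open import Data.Fin.Properties using (toℕ-fromℕ<)
open import Data.Fin.Subset using (Subset; _∈_; _⊆_; _─_; ⋃)
open import Data.Fin.Subset.Properties using (x∈p∪q⁻; ∉⊥; p─q⊆p)
open import Data.Vec.Properties using ([]=⇒lookup; lookup⇒[]=; lookup∘tabulate)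
open import Function using (_∘_; id; flip)
open import Function.Bundles using (Equivalence)
open import Relation.Nullary using (¬_; yes; no)
open import Relation.Unary using (Decidable)
open import Relation.Binary.Definitions using (tri<; tri≈; tri>)
open import Relation.Binary.PropositionalEquality
  using (_≡_; _≢_; refl; sym; trans; cong; cong₂; subst; subst₂; module ≡-Reasoning)

first-witness : ∀ {P : ℕ → Set} → Decidable P → ∀ n →
  (∀ k → k < n → ¬ P k) ⊎ ∃ λ s → s < n × P s × (∀ k → k < s → ¬ P k)
first-witness P? zero = inj₁ λ _ ()
first-witness {P} P? (suc n) with first-witness P? n | P? n
... | inj₂ (s , s<n , Ps , absent) | _      = inj₂ (s , m<n⇒m<1+n s<n , Ps , absent)
... | inj₁ absent                  | yes Pn = inj₂ (n , n<1+n n , Pn , absent)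
... | inj₁ absent                  | no ¬Pn = inj₁ below
  where
  below : ∀ k → k < suc n → ¬ P k
  below k k<1+n with m≤n⇒m<n∨m≡n (s≤s⁻¹ k<1+n)
  ... | inj₁ k<n  = absent k k<n
  ... | inj₂ refl = ¬Pn

pred≡0⇒≡1 : ∀ {x} → 1 ≤ x → pred x ≡ 0 → x ≡ 1
pred≡0⇒≡1 {suc x} _ refl = refl

pred+2≰ : ∀ a → ¬ (pred a + 2 ≤ a)
pred+2≰ zero    ()
pred+2≰ (suc a) a+2≤1+a = 1+n≰n (subst (_≤ suc a) (+-comm a 2) a+2≤1+a)

near-or-zero : ∀ {e a} → e ≤ a → ¬ (1 ≤ e × e + 2 ≤ a) → e ≡ a ⊎ e ≡ pred a ⊎ e ≡ 0
near-or-zero {zero}          _          _         = inj₂ (inj₂ refl)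
near-or-zero {suc e} {suc a} (s≤s e≤a) not-steep with m≤n⇒m<n∨m≡n e≤a
... | inj₂ refl = inj₁ refl
... | inj₁ e<a with m≤n⇒m<n∨m≡n e<a
...   | inj₂ refl  = inj₂ (inj₁ refl)
...   | inj₁ e+1<a = ⊥-elim (not-steep (z<s , s≤s (subst (_≤ a) (+-comm 2 e) e+1<a)))

x∈⋃⁻ : ∀ {n} {x : Fin n} (Js : List (Subset n)) → x ∈ ⋃ Js → ∃ λ J → J ∈ₗ Js × x ∈ J
x∈⋃⁻ []       x∈⋃ = ⊥-elim (∉⊥ x∈⋃)
x∈⋃⁻ (J ∷ Js) x∈⋃ with x∈p∪q⁻ J (⋃ Js) x∈⋃
... | inj₁ x∈J   = J , here refl , x∈J
... | inj₂ x∈⋃Js with x∈⋃⁻ Js x∈⋃Js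
...   | J′ , J′∈Js , x∈J′ = J′ , there J′∈Js , x∈J′

x∈interval⁻ : ∀ {n i j} {x : Fin n} → x ∈ interval i j → i < toℕ x × toℕ x < j
x∈interval⁻ {i = i} {j} {x} x∈ with Equivalence.to T-∧
    (Equivalence.from T-≡ (trans (sym (lookup∘tabulate _ x)) ([]=⇒lookup x∈)))
... | i<x , x<j = <ᵇ⇒< i (toℕ x) i<x , <ᵇ⇒< (toℕ x) j x<j

x∈interval⁺ : ∀ {n i j} {x : Fin n} → i < toℕ x → toℕ x < j → x ∈ interval i j
x∈interval⁺ {x = x} i<x x<j = lookup⇒[]= x _ (trans (lookup∘tabulate _ x)
  (Equivalence.to T-≡ (Equivalence.from T-∧ (<⇒<ᵇ i<x , <⇒<ᵇ x<j))))

module _ {n : ℕ} (Is : List (Subset n)) where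

  InsideSome : Subset n → Set
  InsideSome A = ∃ λ I → I ∈ₗ Is × A ⊆ I

  prune-inside : ∀ U L → All InsideSome L → All InsideSome (prune U L)
  prune-inside U L inside = filter⁺ _ (filter⁺ _ (map⁺ (All.map shrink inside)))
    where
    shrink : ∀ {A} → InsideSome A → InsideSome (A ─ U)
    shrink (I , I∈Is , A⊆I) = I , I∈Is , A⊆I ∘ p─q⊆p _ U

  JRun-inside : ∀ {U L Js} → JRun U L Js → All InsideSome L → All InsideSome Js
  JRun-inside (stop _) _ = []
  JRun-inside (next {U} {L} pruned run) inside
    with subst (All InsideSome) pruned (prune-inside U L inside)
  ... | J-inside ∷ L′-inside = J-inside ∷ JRun-inside run L′-inside

JSeq-inside : ∀ {n} {Is Js : List (Subset n)} → JSeq Is Js → All (InsideSome Is) Js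
JSeq-inside none = []
JSeq-inside (first {I₁} {Is} run) =
  (I₁ , here refl , id) ∷ JRun-inside (I₁ ∷ Is) run (All.tabulate λ {I} I∈Is → I , there I∈Is , id)

fromℕ<∈interval : ∀ {n i j x} (x<n : x < n) → i < x → x < j → fromℕ< x<n ∈ interval i j
fromℕ<∈interval {i = i} {j} x<n i<x x<j = x∈interval⁺
  (subst (i <_) (sym (toℕ-fromℕ< x<n)) i<x) (subst (_< j) (sym (toℕ-fromℕ< x<n)) x<j)

critical⇒inside-MSI : ∀ {u w} (C : MaxChain u w) → Critical C → ∀ x → 0 < x → x < len C →
  ∃₂ λ i j → MSI C i j × i < x × x < j
critical⇒inside-MSI C (_ , (_ , msis , _) , Js , jseq , ⋃Js≡) x 0<x x<len
  with x∈⋃⁻ Js (subst (fromℕ< (m<n⇒m<1+n x<len) ∈_) (sym ⋃Js≡)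
                 (fromℕ<∈interval (m<n⇒m<1+n x<len) 0<x x<len))
... | J , J∈Js , x∈J with All.lookup (JSeq-inside jseq) J∈Js
... | I , I∈Is , J⊆I with ∈-map⁻ _ I∈Is
... | (i , j) , ij∈ps , refl with x∈interval⁻ (J⊆I x∈J)
... | i<x , x<j = i , j , All.lookup msis ij∈ps ,
  subst (i <_) (toℕ-fromℕ< x<1+len) i<x , subst (_< j) (toℕ-fromℕ< x<1+len) x<j
  where x<1+len = m<n⇒m<1+n x<len

-- Expansions

at-decAt-self : ∀ η l → at (decAt l η) l ≡ pred (at η l)
at-decAt-self []      l       = refl
at-decAt-self (x ∷ η) zero    = refl
at-decAt-self (x ∷ η) (suc l) = at-decAt-self η l

at-decAt-other : ∀ η {l q} → l ≢ q → at (decAt l η) q ≡ at η q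
at-decAt-other []      {l}     {q}     l≢q = refl
at-decAt-other (x ∷ η) {zero}  {zero}  l≢q = ⊥-elim (l≢q refl)
at-decAt-other (x ∷ η) {zero}  {suc q} l≢q = refl
at-decAt-other (x ∷ η) {suc l} {zero}  l≢q = refl
at-decAt-other (x ∷ η) {suc l} {suc q} l≢q = at-decAt-other η (l≢q ∘ cong suc)

at-decAt-≤ : ∀ η l q → at (decAt l η) q ≤ at η q
at-decAt-≤ η l q with l ≟ q
... | yes refl = ≤-trans (≤-reflexive (at-decAt-self η l)) pred[n]≤n
... | no l≢q   = ≤-reflexive (at-decAt-other η l≢q)

decAt-comm : ∀ η {l l′} → l ≢ l′ → decAt l (decAt l′ η) ≡ decAt l′ (decAt l η)
decAt-comm []      {l}     {l′}     l≢l′ = refl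
decAt-comm (x ∷ η) {zero}  {zero}   l≢l′ = ⊥-elim (l≢l′ refl)
decAt-comm (x ∷ η) {zero}  {suc l′} l≢l′ = refl
decAt-comm (x ∷ η) {suc l} {zero}   l≢l′ = refl
decAt-comm (x ∷ η) {suc l} {suc l′} l≢l′ = cong (x ∷_) (decAt-comm η (l≢l′ ∘ cong suc))

length-decAt : ∀ η l → length (decAt l η) ≡ length η
length-decAt []      l       = refl
length-decAt (x ∷ η) zero    = refl
length-decAt (x ∷ η) (suc l) = cong suc (length-decAt η l)

sum-decAt : ∀ η l → 1 ≤ at η l → suc (sum (decAt l η)) ≡ sum η
sum-decAt (suc x ∷ η) zero    _   = refl
sum-decAt (x ∷ η)     (suc l) η≥1 = trans (sym (+-suc x _)) (cong (x +_) (sum-decAt η l η≥1))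

decAt-++ˡ : ∀ P X {l} → l < length P → decAt l (P ++ X) ≡ decAt l P ++ X
decAt-++ˡ (x ∷ P) X {zero}  _         = refl
decAt-++ˡ (x ∷ P) X {suc l} (s≤s l<P) = cong (x ∷_) (decAt-++ˡ P X l<P)

decAt-++-length : ∀ P x X → decAt (length P) (P ++ x ∷ X) ≡ P ++ pred x ∷ X
decAt-++-length []      x X = refl
decAt-++-length (y ∷ P) x X = cong (y ∷_) (decAt-++-length P x X)

at-++ˡ : ∀ P X {q} → q < length P → at (P ++ X) q ≡ at P q
at-++ˡ (x ∷ P) X {zero}  _         = refl
at-++ˡ (x ∷ P) X {suc q} (s≤s q<P) = at-++ˡ P X q<P

at-++-length : ∀ P x X → at (P ++ x ∷ X) (length P) ≡ x
at-++-length []      x X = refl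
at-++-length (y ∷ P) x X = at-++-length P x X

at-take : ∀ η {p q} → q < p → at (List.take p η) q ≡ at η q
at-take []      {suc p} {q}     _         = refl
at-take (x ∷ η) {suc p} {zero}  _         = refl
at-take (x ∷ η) {suc p} {suc q} (s≤s q<p) = at-take η q<p

take++at∷drop : ∀ η {p} → p < length η → η ≡ List.take p η ++ at η p ∷ List.drop (suc p) η
take++at∷drop (x ∷ η) {zero}  _         = refl
take++at∷drop (x ∷ η) {suc p} (s≤s p<η) = cong (x ∷_) (take++at∷drop η p<η)

at-positive : ∀ {w} → Positive w → ∀ {q} → q < length w → 1 ≤ at w q
at-positive (w₀≥1 ∷ _)   {zero}  _         = w₀≥1
at-positive (_    ∷ w≥1) {suc q} (s≤s q<w) = at-positive w≥1 q<w

positive-from-at : ∀ P → (∀ q → q < length P → 1 ≤ at P q) → Positive P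
positive-from-at []      _     = []
positive-from-at (x ∷ P) P≥1 = P≥1 0 z<s ∷ positive-from-at P (λ q → P≥1 (suc q) ∘ s≤s)

nz-positive : ∀ {P} → Positive P → nz P ≡ P
nz-positive {[]}        []        = refl
nz-positive {suc x ∷ P} (_ ∷ P≥1) = cong (suc x ∷_) (nz-positive P≥1)

positive-nz : ∀ η → Positive (nz η)
positive-nz []          = []
positive-nz (zero ∷ η)  = positive-nz η
positive-nz (suc x ∷ η) = z<s ∷ positive-nz η

nz-++ : ∀ A B → nz (A ++ B) ≡ nz A ++ nz B
nz-++ []          B = refl
nz-++ (zero ∷ A)  B = nz-++ A B
nz-++ (suc x ∷ A) B = cong (suc x ∷_) (nz-++ A B)

sum-nz : ∀ η → sum (nz η) ≡ sum η
sum-nz []          = refl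
sum-nz (zero ∷ η)  = sum-nz η
sum-nz (suc x ∷ η) = cong (suc x +_) (sum-nz η)

covers-decAt : ∀ η {l} → 1 ≤ at η l → Covers (nz η) (nz (decAt l η))
covers-decAt (suc zero ∷ η)    {zero}  _    = 0 , z<s , refl
covers-decAt (suc (suc x) ∷ η) {zero}  _    = 0 , z<s , refl
covers-decAt (zero ∷ η)        {suc l} ηl≥1 = covers-decAt η ηl≥1
covers-decAt (suc x ∷ η)       {suc l} ηl≥1 with covers-decAt η ηl≥1
... | i , i<η , eq = suc i , s≤s i<η , cong (suc x ∷_) eq

nz-decAt-prefix : ∀ P {b} R {l} → l < length P → 1 ≤ b →
  nz (decAt l (P ++ b ∷ R)) ≡ nz (decAt l P) ++ b ∷ nz R
nz-decAt-prefix P {suc b} R {l} l<P _ =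
  trans (cong nz (decAt-++ˡ P (suc b ∷ R) l<P)) (nz-++ (decAt l P) (suc b ∷ R))

≼-refl : ∀ {A} → A ≼ A
≼-refl {[]}    = nil
≼-refl {x ∷ A} = take ≤-refl ≼-refl

≼-trans : ∀ {A B C} → A ≼ B → B ≼ C → A ≼ C
≼-trans nil        _          = nil
≼-trans A≼B        (skip B≼C) = skip (≼-trans A≼B B≼C)
≼-trans (skip A≼B) (take _ B≼C) = skip (≼-trans A≼B B≼C)
≼-trans (take a≤b A≼B) (take b≤c B≼C) = take (≤-trans a≤b b≤c) (≼-trans A≼B B≼C)

≼-++ : ∀ {A B C D} → A ≼ B → C ≼ D → A ++ C ≼ B ++ D
≼-++ {B = []}    nil C≼D = C≼D
≼-++ {B = _ ∷ B} nil C≼D = skip (≼-++ {B = B} nil C≼D)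
≼-++ (skip A≼B)     C≼D = skip (≼-++ A≼B C≼D)
≼-++ (take a≤b A≼B) C≼D = take a≤b (≼-++ A≼B C≼D)

nz-decAt-≼ : ∀ η l → nz (decAt l η) ≼ nz η
nz-decAt-≼ []                  l       = nil
nz-decAt-≼ (zero ∷ η)          zero    = ≼-refl
nz-decAt-≼ (suc zero ∷ η)      zero    = skip ≼-refl
nz-decAt-≼ (suc (suc x) ∷ η)   zero    = take (n≤1+n _) ≼-refl
nz-decAt-≼ (zero ∷ η)          (suc l) = nz-decAt-≼ η l
nz-decAt-≼ (suc x ∷ η)         (suc l) = take ≤-refl (nz-decAt-≼ η l)

sum-mono-≼ : ∀ {A B} → A ≼ B → sum A ≤ sum B
sum-mono-≼ nil                      = z≤n
sum-mono-≼ {B = x ∷ B} (skip A≼B)   = ≤-trans (sum-mono-≼ A≼B) (m≤n+m (sum B) x)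
sum-mono-≼ (take a≤x A≼B)           = +-mono-≤ a≤x (sum-mono-≼ A≼B)

length-mono-≼ : ∀ {A B} → A ≼ B → length A ≤ length B
length-mono-≼ nil          = z≤n
length-mono-≼ (skip A≼B)   = m≤n⇒m≤1+n (length-mono-≼ A≼B)
length-mono-≼ (take _ A≼B) = s≤s (length-mono-≼ A≼B)

≼-absorbs-prefix : ∀ X {Q} → X ++ Q ≼ Q → X ≡ []
≼-absorbs-prefix []          _   = refl
≼-absorbs-prefix (x ∷ X) {Q} XQ≼Q =
  ⊥-elim (<-irrefl refl (<-≤-trans (s≤s (length-++-≤ʳ Q {X})) (length-mono-≼ XQ≼Q)))

-- Y is too light to absorb all of X, and the common tail Q leaves room for
-- only one more entry of X, which must be matched against c.
heavy-prefix-≼⁻ : ∀ X Y Q c → X ++ Q ≼ Y ++ c ∷ Q → sum Y < sum X →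
  ∃₂ λ X₀ x → X ≡ X₀ ++ [ x ] × X₀ ≼ Y × x ≤ c
heavy-prefix-≼⁻ []      Y       Q c _   ()
heavy-prefix-≼⁻ (a ∷ X) []      Q c (skip aXQ≼Q) _ = ⊥-elim (∷≢[] (≼-absorbs-prefix (a ∷ X) aXQ≼Q))
  where
  ∷≢[] : a ∷ X ≢ []
  ∷≢[] ()
heavy-prefix-≼⁻ (a ∷ X) []      Q c (take a≤c XQ≼Q) _ with ≼-absorbs-prefix X XQ≼Q
... | refl = [] , a , refl , nil , a≤c
heavy-prefix-≼⁻ (a ∷ X) (y ∷ Y) Q c (skip aXQ≼YcQ) Y<X
  with heavy-prefix-≼⁻ (a ∷ X) Y Q c aXQ≼YcQ (≤-<-trans (m≤n+m (sum Y) y) Y<X)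
... | X₀ , x , X≡ , X₀≼Y , x≤c = X₀ , x , X≡ , skip X₀≼Y , x≤c
heavy-prefix-≼⁻ (a ∷ X) (y ∷ Y) Q c (take a≤y XQ≼YcQ) Y<X
  with heavy-prefix-≼⁻ X Y Q c XQ≼YcQ
         (+-cancelˡ-< a (sum Y) (sum X) (≤-<-trans (+-monoˡ-≤ (sum Y) a≤y) Y<X))
... | X₀ , x , X≡ , X₀≼Y , x≤c = a ∷ X₀ , x , cong (a ∷_) X≡ , take a≤y X₀≼Y , x≤c

heavy-prefix-≼-last : ∀ {P Y Q x c} → sum Y < sum P → ¬ (P ++ x ∷ Q ≼ Y ++ c ∷ Q)
heavy-prefix-≼-last {P} {Y} {Q} {x} {c} Y<P PxQ≼YcQ
  with heavy-prefix-≼⁻ (P ++ [ x ]) Y Q c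
         (subst (_≼ Y ++ c ∷ Q) (sym (++-assoc P [ x ] Q)) PxQ≼YcQ)
         (<-≤-trans Y<P (≤-trans (m≤m+n (sum P) (x + 0)) (≤-reflexive (sym (sum-++ P [ x ])))))
... | X₀ , _ , Px≡X₀y , X₀≼Y , _ =
  <⇒≱ Y<P (subst (λ X → sum X ≤ sum Y) (sym (∷ʳ-injectiveˡ P X₀ Px≡X₀y)) (sum-mono-≼ X₀≼Y))

-- Labels

ValidLabel : List ℕ → ℕ → Set
ValidLabel η l = 1 ≤ at η l × (at η l ≡ 1 → LeftmostOne η l)

NonzeroBefore : List ℕ → ℕ → Set
NonzeroBefore η l = ∃ λ m → m < l × at η m ≢ 0

nonzeroBefore? : ∀ η l → NonzeroBefore η l ⊎ (∀ m → m < l → at η m ≡ 0)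
nonzeroBefore? η           zero    = inj₂ λ _ ()
nonzeroBefore? []          (suc l) = inj₂ λ _ _ → refl
nonzeroBefore? (suc x ∷ η) (suc l) = inj₁ (0 , z<s , λ ())
nonzeroBefore? (zero ∷ η)  (suc l) with nonzeroBefore? η l
... | inj₁ (m , m<l , ηm≢0) = inj₁ (suc m , s≤s m<l , ηm≢0)
... | inj₂ zeros            = inj₂ λ { zero _ → refl ; (suc m) m<1+l → zeros m (s≤s⁻¹ m<1+l) }

LeftmostOne-transfer : ∀ {η η′ l} → (∀ q → q < l → at η q ≡ at η′ q) → LeftmostOne η l → LeftmostOne η′ l
LeftmostOne-transfer agree leftmost k k<l η′k≡1 with leftmost k k<l (trans (agree k k<l) η′k≡1)
... | m , k<m , m<l , ηm≢0 = m , k<m , m<l , ηm≢0 ∘ trans (agree m m<l)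

ValidLabel-transfer : ∀ η η′ {l} → (∀ q → q ≤ l → at η q ≡ at η′ q) → ValidLabel η l → ValidLabel η′ l
ValidLabel-transfer η η′ {l} agree (ηl≥1 , leftmost) =
  subst (1 ≤_) (agree l ≤-refl) ηl≥1 ,
  λ η′l≡1 → LeftmostOne-transfer {η} {η′} (λ q → agree q ∘ <⇒≤) (leftmost (trans (agree l ≤-refl) η′l≡1))

LeftmostOne-after-one : ∀ η {q} → at η q ≡ 1 → ¬ LeftmostOne η (suc q)
LeftmostOne-after-one η {q} ηq≡1 leftmost with leftmost q (n<1+n q) ηq≡1
... | m , q<m , m<1+q , _ = <⇒≱ q<m (s≤s⁻¹ m<1+q)

LeftmostOne-zero : ∀ η → LeftmostOne η 0
LeftmostOne-zero η k ()

LeftmostOne-∷⁻ : ∀ {x η l} → LeftmostOne (x ∷ η) (suc l) → LeftmostOne η l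
LeftmostOne-∷⁻ leftmost k k<l ηk≡1 with leftmost (suc k) (s≤s k<l) ηk≡1
... | suc m , s≤s k<m , s≤s m<l , ηm≢0 = m , k<m , m<l , ηm≢0

LeftmostOne-1∷⁻ : ∀ {η l} → LeftmostOne (1 ∷ η) (suc l) → NonzeroBefore η l
LeftmostOne-1∷⁻ leftmost with leftmost 0 z<s refl
... | suc m , _ , s≤s m<l , ηm≢0 = m , m<l , ηm≢0

LeftmostOne-∷⁺ : ∀ {x η l} → (x ≡ 1 → NonzeroBefore η l) → LeftmostOne η l → LeftmostOne (x ∷ η) (suc l)
LeftmostOne-∷⁺ separated leftmost zero    _         x≡1 with separated x≡1
... | m , m<l , ηm≢0 = suc m , z<s , s≤s m<l , ηm≢0
LeftmostOne-∷⁺ separated leftmost (suc k) (s≤s k<l) ηk≡1 with leftmost k k<l ηk≡1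
... | m , k<m , m<l , ηm≢0 = suc m , s≤s k<m , s≤s m<l , ηm≢0

-- The hypothesis puts the entry at l, if it is a 1, outside the run of the
-- leading 1, so deleting the latter cannot have the same effect.
nz≢1∷nz-decAt : ∀ η l → 1 ≤ at η l → (at η l ≡ 1 → LeftmostOne η l × NonzeroBefore η l) →
  nz η ≢ 1 ∷ nz (decAt l η)
nz≢1∷nz-decAt (suc zero ∷ η)    zero    _    separated _ with proj₂ (separated refl)
... | _ , () , _
nz≢1∷nz-decAt (suc (suc x) ∷ η) zero    _    _         ()
nz≢1∷nz-decAt (zero ∷ η)        (suc l) ηl≥1 separated eq =
  nz≢1∷nz-decAt η l ηl≥1
    (λ ηl≡1 → let lo , nzb = separated ηl≡1 in LeftmostOne-∷⁻ lo , nonzero-tail nzb) eq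
  where
  nonzero-tail : NonzeroBefore (0 ∷ η) (suc l) → NonzeroBefore η l
  nonzero-tail (suc m , s≤s m<l , ηm≢0) = m , m<l , ηm≢0
  nonzero-tail (zero , _ , 0≢0) = ⊥-elim (0≢0 refl)
nz≢1∷nz-decAt (suc zero ∷ η)    (suc l) ηl≥1 separated eq =
  nz≢1∷nz-decAt η l ηl≥1
    (λ ηl≡1 → let lo = proj₁ (separated ηl≡1) in LeftmostOne-∷⁻ lo , LeftmostOne-1∷⁻ lo)
    (∷-injectiveʳ eq)
nz≢1∷nz-decAt (suc (suc x) ∷ η) (suc l) _    _         ()

nz-decAt-≢ : ∀ η {l l′} → l < l′ → 1 ≤ at η l → ValidLabel η l′ → nz (decAt l η) ≢ nz (decAt l′ η)
nz-decAt-≢ (suc zero ∷ η)    {zero}  {suc l′} _ _ (ηl′≥1 , leftmost) =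
  nz≢1∷nz-decAt η l′ ηl′≥1 λ ηl′≡1 → LeftmostOne-∷⁻ (leftmost ηl′≡1) , LeftmostOne-1∷⁻ (leftmost ηl′≡1)
nz-decAt-≢ (suc (suc x) ∷ η) {zero}  {suc l′} _ _ _ ()
nz-decAt-≢ (zero ∷ η)        {suc l} {suc l′} (s≤s l<l′) ηl≥1 (ηl′≥1 , leftmost) eq =
  nz-decAt-≢ η l<l′ ηl≥1 (ηl′≥1 , LeftmostOne-∷⁻ ∘ leftmost) eq
nz-decAt-≢ (suc x ∷ η)       {suc l} {suc l′} (s≤s l<l′) ηl≥1 (ηl′≥1 , leftmost) eq =
  nz-decAt-≢ η l<l′ ηl≥1 (ηl′≥1 , LeftmostOne-∷⁻ ∘ leftmost) (∷-injectiveʳ eq)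

LabelStep⇒ValidLabel : ∀ {η y l η′} → LabelStep η y l η′ → ValidLabel η l
LabelStep⇒ValidLabel (ηl≥1 , _ , _ , leftmost) = ηl≥1 , leftmost

LabelStep-unique : ∀ {η y l l′ η₁ η₂} → LabelStep η y l η₁ → LabelStep η y l′ η₂ → l ≡ l′
LabelStep-unique {η} {l = l} {l′} step@(_ , η₁≡ , nzη₁≡ , _) step′@(_ , η₂≡ , nzη₂≡ , _) with <-cmp l l′
... | tri≈ _ l≡l′ _ = l≡l′
... | tri< l<l′ _ _ = ⊥-elim (nz-decAt-≢ η l<l′ (proj₁ step) (LabelStep⇒ValidLabel step′) same)
  where same = trans (cong nz (sym η₁≡)) (trans nzη₁≡ (trans (sym nzη₂≡) (cong nz η₂≡)))
... | tri> _ _ l′<l = ⊥-elim (nz-decAt-≢ η l′<l (proj₁ step′) (LabelStep⇒ValidLabel step) same)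
  where same = trans (cong nz (sym η₂≡)) (trans nzη₂≡ (trans (sym nzη₁≡) (cong nz η₁≡)))

nz-leading-one : ∀ η l → (∀ m → m < l → at η m ≡ 0) → at η l ≡ 1 → nz η ≡ 1 ∷ nz (decAt l η)
nz-leading-one (suc zero ∷ η) zero    _     _    = refl
nz-leading-one (x ∷ η)        (suc l) zeros ηl≡1 with zeros 0 z<s
... | refl = nz-leading-one η l (λ m → zeros (suc m) ∘ s≤s) ηl≡1

decDel-label : ∀ η i → i < length (nz η) → ∃ λ l → ValidLabel η l × nz (decAt l η) ≡ decDel i (nz η)
decDel-label (zero ∷ η)        i       i<η with decDel-label η i i<η
... | l , (ηl≥1 , leftmost) , eq = suc l , (ηl≥1 , LeftmostOne-∷⁺ (λ ()) ∘ leftmost) , eq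
decDel-label (suc zero ∷ η)    zero    _   = 0 , (z<s , λ _ → LeftmostOne-zero (1 ∷ η)) , refl
decDel-label (suc (suc x) ∷ η) zero    _   = 0 , (z<s , λ _ → LeftmostOne-zero (suc (suc x) ∷ η)) , refl
decDel-label (suc (suc x) ∷ η) (suc i) (s≤s i<η) with decDel-label η i i<η
... | l , (ηl≥1 , leftmost) , eq =
  suc l , (ηl≥1 , LeftmostOne-∷⁺ (λ ()) ∘ leftmost) , cong (suc (suc x) ∷_) eq
decDel-label (suc zero ∷ η)    (suc i) (s≤s i<η) with decDel-label η i i<η
... | l , (ηl≥1 , leftmost) , eq with at η l ≟ 1 | nonzeroBefore? η l
...   | no ηl≢1  | _          = suc l , (ηl≥1 , ⊥-elim ∘ ηl≢1) , cong (1 ∷_) eq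
...   | yes _    | inj₁ nzb   =
  suc l , (ηl≥1 , λ ηl≡1 → LeftmostOne-∷⁺ (λ _ → nzb) (leftmost ηl≡1)) , cong (1 ∷_) eq
-- only zeros separate the leading 1 from the 1 at l, so they share a run and
-- deleting the latter is deleting the leading 1, labelled 0
...   | yes ηl≡1 | inj₂ zeros =
  0 , (z<s , λ _ → LeftmostOne-zero (1 ∷ η)) , trans (nz-leading-one η l zeros ηl≡1) (cong (1 ∷_) eq)

covers-label : ∀ η {x y} → nz η ≡ x → Covers x y → ∃ λ l → ValidLabel η l × nz (decAt l η) ≡ y
covers-label η refl (i , i<x , refl) = decDel-label η i i<x

-- Paths of covers and their labellings

data CoverPath : Word → Word → Set where
  []  : ∀ {x} → CoverPath x x
  _∷_ : ∀ {x y z} → Covers x y → CoverPath y z → CoverPath x z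

_++ᶜ_ : ∀ {x y z} → CoverPath x y → CoverPath y z → CoverPath x z
[]      ++ᶜ q = q
(c ∷ p) ++ᶜ q = c ∷ (p ++ᶜ q)

CoverPath-∷⁺ : ∀ a {x z} → CoverPath x z → CoverPath (a ∷ x) (a ∷ z)
CoverPath-∷⁺ a []                   = []
CoverPath-∷⁺ a ((i , i<x , refl) ∷ p) = (suc i , s≤s i<x , refl) ∷ CoverPath-∷⁺ a p

delete-head : ∀ x r → CoverPath (suc x ∷ r) r
delete-head zero    r = (0 , z<s , refl) ∷ []
delete-head (suc x) r = (0 , z<s , refl) ∷ delete-head x r

lower-head : ∀ d a r → CoverPath (suc (d + a) ∷ r) (suc a ∷ r)
lower-head zero    a r = []
lower-head (suc d) a r = (0 , z<s , refl) ∷ lower-head d a r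

≼⇒CoverPath : ∀ {A B} → Positive A → Positive B → A ≼ B → CoverPath B A
≼⇒CoverPath {B = []}        _ _ nil = []
≼⇒CoverPath {B = suc x ∷ B} A≥1 (_ ∷ B≥1) nil = delete-head x B ++ᶜ ≼⇒CoverPath A≥1 B≥1 nil
≼⇒CoverPath {A} {suc x ∷ B} A≥1 (_ ∷ B≥1) (skip A≼B) =
  CoverPath-∷⁺ (suc x) (≼⇒CoverPath A≥1 B≥1 A≼B) ++ᶜ delete-head x A
≼⇒CoverPath {suc a ∷ A} {suc x ∷ B} (_ ∷ A≥1) (_ ∷ B≥1) (take (s≤s a≤x) A≼B) =
  CoverPath-∷⁺ (suc x) (≼⇒CoverPath A≥1 B≥1 A≼B)
  ++ᶜ subst (λ y → CoverPath (suc y ∷ A) (suc a ∷ A)) (m∸n+n≡m a≤x) (lower-head (x ∸ a) a A)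

data LabelledPath : List ℕ → List ℕ → ℕ → Set where
  done : ∀ {η} → LabelledPath η η 0
  step : ∀ {η η′ n} l → ValidLabel η l → LabelledPath (decAt l η) η′ n → LabelledPath η η′ (suc n)

_++ᴸ_ : ∀ {η η′ η″ n n′} → LabelledPath η η′ n → LabelledPath η′ η″ n′ → LabelledPath η η″ (n + n′)
done           ++ᴸ T′ = T′
step l valid T ++ᴸ T′ = step l valid (T ++ᴸ T′)

pathExpansion : ∀ {η η′ n} → LabelledPath η η′ n → ℕ → List ℕ
pathExpansion {η} done               _       = η
pathExpansion {η} (step l valid T)   zero    = η
pathExpansion     (step l valid T)   (suc k) = pathExpansion T k

pathLabel : ∀ {η η′ n} → LabelledPath η η′ n → ℕ → ℕ
pathLabel done             _       = 0
pathLabel (step l valid T) zero    = l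
pathLabel (step l valid T) (suc k) = pathLabel T k

pathExpansion-zero : ∀ {η η′ n} (T : LabelledPath η η′ n) → pathExpansion T 0 ≡ η
pathExpansion-zero done             = refl
pathExpansion-zero (step l valid T) = refl

pathExpansion-end : ∀ {η η′ n} (T : LabelledPath η η′ n) → pathExpansion T n ≡ η′
pathExpansion-end done             = refl
pathExpansion-end (step l valid T) = pathExpansion-end T

pathExpansion-++ʳ : ∀ {η η′ η″ n n′} (T : LabelledPath η η′ n) (T′ : LabelledPath η′ η″ n′) k →
  pathExpansion (T ++ᴸ T′) (n + k) ≡ pathExpansion T′ k
pathExpansion-++ʳ done             T′ k = refl
pathExpansion-++ʳ (step l valid T) T′ k = pathExpansion-++ʳ T T′ k

path-step : ∀ {η η′ n} (T : LabelledPath η η′ n) k → k < n →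
  ValidLabel (pathExpansion T k) (pathLabel T k) ×
  pathExpansion T (suc k) ≡ decAt (pathLabel T k) (pathExpansion T k)
path-step (step l valid T) zero    _         = valid , pathExpansion-zero T
path-step (step l valid T) (suc k) (s≤s k<n) = path-step T k k<n

relabel-path : ∀ {x z} → CoverPath x z → ∀ η → nz η ≡ x → ∃₂ λ η′ n → LabelledPath η η′ n × nz η′ ≡ z
relabel-path []      η nzη≡x = η , 0 , done , nzη≡x
relabel-path (c ∷ p) η nzη≡x with covers-label η nzη≡x c
... | l , valid , nzη₁≡y with relabel-path p (decAt l η) nzη₁≡y
... | η′ , n , T , nzη′≡z = η′ , suc n , step l valid T , nzη′≡z

relabel-sequence : ∀ (f : ℕ → Word) n → (∀ i → i < n → Covers (f i) (f (suc i))) → ∀ η → nz η ≡ f 0 →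
  ∃₂ λ η′ (T : LabelledPath η η′ n) → ∀ i → i ≤ n → nz (pathExpansion T i) ≡ f i
relabel-sequence f zero    _      η nzη≡f₀ = η , done , λ { zero _ → nzη≡f₀ }
relabel-sequence f (suc n) covers η nzη≡f₀ with covers-label η nzη≡f₀ (covers 0 z<s)
... | l , valid , nzη₁≡f₁
  with relabel-sequence (f ∘ suc) n (λ i → covers (suc i) ∘ s≤s) (decAt l η) nzη₁≡f₁
... | η′ , T , T≡f = η′ , step l valid T , λ { zero _ → nzη≡f₀ ; (suc i) i<n → T≡f i (s≤s⁻¹ i<n) }

-- Maximal chains

module _ {u w : Word} (C : MaxChain u w) where

  η-step : ∀ k → k < len C → η C (suc k) ≡ decAt (lab C k) (η C k)
  η-step k k<len = proj₁ (proj₂ (steps C k k<len))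

  label-valid : ∀ k → k < len C → ValidLabel (η C k) (lab C k)
  label-valid k k<len = LabelStep⇒ValidLabel (steps C k k<len)

  tail-covers : ∀ {j} → j ≤ len C → ∀ k → k < len C ∸ j → Covers (v C (j + k)) (v C (j + suc k))
  tail-covers {j} j≤len k k<len-j = subst (Covers (v C (j + k)) ∘ v C) (sym (+-suc j k))
    (covers C (j + k) (subst (j + k <_) (m+[n∸m]≡n j≤len) (+-monoʳ-< j k<len-j)))

  length-η : ∀ k → k ≤ len C → length (η C k) ≡ length w
  length-η zero    _        = cong length (η-top C)
  length-η (suc k) 1+k≤len = begin
    length (η C (suc k))             ≡⟨ cong length (η-step k 1+k≤len) ⟩
    length (decAt (lab C k) (η C k)) ≡⟨ length-decAt (η C k) (lab C k) ⟩
    length (η C k)                   ≡⟨ length-η k (<⇒≤ 1+k≤len) ⟩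
    length w                         ∎
    where open ≡-Reasoning

  at-η-untouched : ∀ {a b q} → a ≤ b → b ≤ len C → (∀ k → a ≤ k → k < b → lab C k ≢ q) →
    at (η C b) q ≡ at (η C a) q
  at-η-untouched {b = zero}  z≤n _ _ = refl
  at-η-untouched {a} {suc b} {q} a≤1+b 1+b≤len untouched with m≤n⇒m<n∨m≡n a≤1+b
  ... | inj₂ refl  = refl
  ... | inj₁ a<1+b = begin
    at (η C (suc b)) q             ≡⟨ cong (λ ξ → at ξ q) (η-step b 1+b≤len) ⟩
    at (decAt (lab C b) (η C b)) q ≡⟨ at-decAt-other (η C b) (untouched b a≤b (n<1+n b)) ⟩
    at (η C b) q                   ≡⟨ at-η-untouched a≤b (<⇒≤ 1+b≤len)
                                           (λ k a≤k → untouched k a≤k ∘ m<n⇒m<1+n) ⟩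
    at (η C a) q                   ∎
    where
    open ≡-Reasoning
    a≤b = s≤s⁻¹ a<1+b

  at-η-antitone : ∀ {a b} q → a ≤ b → b ≤ len C → at (η C b) q ≤ at (η C a) q
  at-η-antitone {b = zero}  q z≤n _ = ≤-refl
  at-η-antitone {a} {suc b} q a≤1+b 1+b≤len with m≤n⇒m<n∨m≡n a≤1+b
  ... | inj₂ refl  = ≤-refl
  ... | inj₁ a<1+b = begin
    at (η C (suc b)) q             ≡⟨ cong (λ ξ → at ξ q) (η-step b 1+b≤len) ⟩
    at (decAt (lab C b) (η C b)) q ≤⟨ at-decAt-≤ (η C b) (lab C b) q ⟩
    at (η C b) q                   ≤⟨ at-η-antitone q (s≤s⁻¹ a<1+b) (<⇒≤ 1+b≤len) ⟩
    at (η C a) q                   ∎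
    where open ≤-Reasoning

  at-η-unchanged : ∀ {s p} → s ≤ len C → (∀ k → k < s → p < lab C k) →
    ∀ q → q ≤ p → at (η C s) q ≡ at w q
  at-η-unchanged {p = p} s≤len above q q≤p = trans
    (at-η-untouched z≤n s≤len λ k _ k<s lab≡q → <⇒≱ (above k k<s) (subst (_≤ p) (sym lab≡q) q≤p))
    (cong (λ ξ → at ξ q) (η-top C))

  label-antitone : WeaklyDecreasing C → ∀ {k k′} → k ≤ k′ → k′ < len C → lab C k′ ≤ lab C k
  label-antitone wd {k′ = zero}   z≤n  _        = ≤-refl
  label-antitone wd {k} {suc k′} k≤1+k′ 1+k′<len with m≤n⇒m<n∨m≡n k≤1+k′
  ... | inj₂ refl   = ≤-refl
  ... | inj₁ k<1+k′ =
    ≤-trans (wd k′ 1+k′<len) (label-antitone wd (s≤s⁻¹ k<1+k′) (<-trans (n<1+n k′) 1+k′<len))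

  η-repeated-label : ∀ {s t p} → s + t ≤ len C → (∀ k → s ≤ k → k < s + t → lab C k ≡ p) →
    p < length (η C s) → ∀ n → n ≤ t →
    η C (s + n) ≡ List.take p (η C s) ++ (at (η C s) p ∸ n) ∷ List.drop (suc p) (η C s)
  η-repeated-label {s} {t} {p} _ _ p<η zero _ =
    trans (cong (η C) (+-identityʳ s)) (take++at∷drop (η C s) p<η)
  η-repeated-label {s} {t} {p} s+t≤len labels p<η (suc n) 1+n≤t = begin
    η C (s + suc n)                       ≡⟨ cong (η C) (+-suc s n) ⟩
    η C (suc (s + n))                     ≡⟨ η-step (s + n) (≤-trans s+n<s+t s+t≤len) ⟩
    decAt (lab C (s + n)) (η C (s + n))   ≡⟨ cong₂ decAt
                                               (labels (s + n) (m≤m+n s n) s+n<s+t)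
                                               (η-repeated-label s+t≤len labels p<η n (<⇒≤ 1+n≤t)) ⟩
    decAt p (P ++ (a ∸ n) ∷ R)            ≡⟨ cong (λ l → decAt l (P ++ (a ∸ n) ∷ R)) (sym P-length) ⟩
    decAt (length P) (P ++ (a ∸ n) ∷ R)   ≡⟨ decAt-++-length P (a ∸ n) R ⟩
    P ++ pred (a ∸ n) ∷ R                 ≡⟨ cong (λ x → P ++ x ∷ R) (pred[m∸n]≡m∸[1+n] a n) ⟩
    P ++ (a ∸ suc n) ∷ R                  ∎
    where
    open ≡-Reasoning
    P = List.take p (η C s)
    R = List.drop (suc p) (η C s)
    a = at (η C s) p
    s+n<s+t = +-monoʳ-< s 1+n≤t
    P-length : length P ≡ p
    P-length = trans (length-take p (η C s)) (m≤n⇒m⊓n≡m (<⇒≤ p<η))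

η-agree : ∀ {u w} (C C′ : MaxChain u w) m → (∀ k → k < m → lab C′ k ≡ lab C k) →
  m ≤ len C → m ≤ len C′ → η C′ m ≡ η C m
η-agree C C′ zero    _      _        _         = trans (η-top C′) (sym (η-top C))
η-agree C C′ (suc m) agree 1+m≤len 1+m≤len′ = begin
  η C′ (suc m)                   ≡⟨ η-step C′ m 1+m≤len′ ⟩
  decAt (lab C′ m) (η C′ m)      ≡⟨ cong₂ decAt (agree m (n<1+n m))
                                      (η-agree C C′ m (λ k → agree k ∘ m<n⇒m<1+n)
                                                      (<⇒≤ 1+m≤len) (<⇒≤ 1+m≤len′)) ⟩
  decAt (lab C m) (η C m)        ≡⟨ η-step C m 1+m≤len ⟨
  η C (suc m)                    ∎
  where open ≡-Reasoning

splice : {A : Set} → ℕ → (ℕ → A) → (ℕ → A) → ℕ → A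
splice zero    f g k       = g k
splice (suc m) f g zero    = f zero
splice (suc m) f g (suc k) = splice m (f ∘ suc) g k

splice-< : {A : Set} → ∀ m (f g : ℕ → A) {k} → k < m → splice m f g k ≡ f k
splice-< (suc m) f g {zero}  _         = refl
splice-< (suc m) f g {suc k} (s≤s k<m) = splice-< m (f ∘ suc) g k<m

splice-+ : {A : Set} → ∀ m (f g : ℕ → A) k → splice m f g (m + k) ≡ g k
splice-+ zero    f g k = refl
splice-+ (suc m) f g k = splice-+ m (f ∘ suc) g k

module _ {u w : Word} (w≥1 : Positive w) where

  v≡nz-η : (C : MaxChain u w) → ∀ k → k ≤ len C → v C k ≡ nz (η C k)
  v≡nz-η C zero    _       = trans (v-top C) (sym (trans (cong nz (η-top C)) (nz-positive w≥1)))
  v≡nz-η C (suc k) 1+k≤len = sym (proj₁ (proj₂ (proj₂ (steps C k 1+k≤len))))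

  v-positive : (C : MaxChain u w) → ∀ k → k ≤ len C → Positive (v C k)
  v-positive C k k≤len = subst Positive (sym (v≡nz-η C k k≤len)) (positive-nz (η C k))

  sum-η+index : (C : MaxChain u w) → ∀ k → k ≤ len C → sum (η C k) + k ≡ sum w
  sum-η+index C zero    _       = trans (+-identityʳ _) (cong sum (η-top C))
  sum-η+index C (suc k) 1+k≤len = begin
    sum (η C (suc k)) + suc k                 ≡⟨ +-suc _ k ⟩
    suc (sum (η C (suc k))) + k               ≡⟨ cong (λ ξ → suc (sum ξ) + k) (η-step C k 1+k≤len) ⟩
    suc (sum (decAt (lab C k) (η C k))) + k   ≡⟨ cong (_+ k) (sum-decAt (η C k) (lab C k)
                                                                  (proj₁ (label-valid C k 1+k≤len))) ⟩
    sum (η C k) + k                           ≡⟨ sum-η+index C k (<⇒≤ 1+k≤len) ⟩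
    sum w                                     ∎
    where open ≡-Reasoning

  sum-v+index : (C : MaxChain u w) → ∀ k → k ≤ len C → sum (v C k) + k ≡ sum w
  sum-v+index C k k≤len = begin
    sum (v C k) + k       ≡⟨ cong (λ x → sum x + k) (v≡nz-η C k k≤len) ⟩
    sum (nz (η C k)) + k  ≡⟨ cong (_+ k) (sum-nz (η C k)) ⟩
    sum (η C k) + k       ≡⟨ sum-η+index C k k≤len ⟩
    sum w                 ∎
    where open ≡-Reasoning

  -- Along every maximal chain the index of v is sum w − sum v.
  index-unique : (C C′ : MaxChain u w) → ∀ {k k′} → v C′ k′ ≡ v C k → k′ ≤ len C′ → k ≤ len C → k′ ≡ k
  index-unique C C′ {k} {k′} v≡ k′≤len′ k≤len = +-cancelˡ-≡ (sum (v C k)) k′ k (begin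
    sum (v C k) + k′   ≡⟨ cong (λ x → sum x + k′) v≡ ⟨
    sum (v C′ k′) + k′ ≡⟨ sum-v+index C′ k′ k′≤len′ ⟩
    sum w              ≡⟨ sum-v+index C k k≤len ⟨
    sum (v C k) + k    ∎)
    where open ≡-Reasoning

  len-unique : (C C′ : MaxChain u w) → len C′ ≡ len C
  len-unique C C′ = index-unique C C′ (trans (v-bot C′) (sym (v-bot C))) ≤-refl ≤-refl

  v-antitone : (C : MaxChain u w) → ∀ {k k′} → k ≤ k′ → k′ ≤ len C → v C k′ ≼ v C k
  v-antitone C {k′ = zero}   z≤n      _         = ≼-refl
  v-antitone C {k} {suc k′} k≤1+k′ 1+k′≤len with m≤n⇒m<n∨m≡n k≤1+k′
  ... | inj₂ refl   = ≼-refl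
  ... | inj₁ k<1+k′ = ≼-trans v₁≼v (v-antitone C (s≤s⁻¹ k<1+k′) (<⇒≤ 1+k′≤len))
    where
    v₁≼v : v C (suc k′) ≼ v C k′
    v₁≼v = subst₂ _≼_ (sym (trans (v≡nz-η C (suc k′) 1+k′≤len) (cong nz (η-step C k′ 1+k′≤len))))
                      (sym (v≡nz-η C k′ (<⇒≤ 1+k′≤len)))
                      (nz-decAt-≼ (η C k′) (lab C k′))

  module Graft (C : MaxChain u w) {m η′ n} (m≤len : m ≤ len C)
               (T : LabelledPath (η C m) η′ n) (η′↦u : nz η′ ≡ u) where

    expansion : ℕ → List ℕ
    expansion = splice m (η C) (pathExpansion T)

    label : ℕ → ℕ
    label = splice m (lab C) (pathLabel T)

    expansion-+ : ∀ k → expansion (m + k) ≡ pathExpansion T k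
    expansion-+ = splice-+ m (η C) (pathExpansion T)

    label-+ : ∀ k → label (m + k) ≡ pathLabel T k
    label-+ = splice-+ m (lab C) (pathLabel T)

    label-< : ∀ k → k < m → label k ≡ lab C k
    label-< k = splice-< m (lab C) (pathLabel T)

    expansion-≤ : ∀ k → k ≤ m → expansion k ≡ η C k
    expansion-≤ k k≤m with m≤n⇒m<n∨m≡n k≤m
    ... | inj₁ k<m  = splice-< m (η C) (pathExpansion T) k<m
    ... | inj₂ refl =
      trans (cong expansion (sym (+-identityʳ k))) (trans (expansion-+ 0) (pathExpansion-zero T))

    Step : ℕ → Set
    Step j = ValidLabel (expansion j) (label j) × expansion (suc j) ≡ decAt (label j) (expansion j)

    step-< : ∀ j → j < m → Step j
    step-< j j<m rewrite expansion-≤ j (<⇒≤ j<m) | label-< j j<m | expansion-≤ (suc j) j<m =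
      label-valid C j (<-≤-trans j<m m≤len) , η-step C j (<-≤-trans j<m m≤len)

    step-+ : ∀ i → i < n → Step (m + i)
    step-+ i i<n rewrite expansion-+ i | label-+ i | sym (+-suc m i) | expansion-+ (suc i) =
      path-step T i i<n

    graft-step : ∀ j → j < m + n → Step j
    graft-step j j<m+n with j <? m
    ... | yes j<m = step-< j j<m
    ... | no  j≮m = subst Step (m+[n∸m]≡n (≮⇒≥ j≮m)) (step-+ (j ∸ m)
                      (+-cancelˡ-< m (j ∸ m) n (subst (_< m + n) (sym (m+[n∸m]≡n (≮⇒≥ j≮m))) j<m+n)))

    η-top-graft : expansion 0 ≡ w
    η-top-graft = trans (expansion-≤ 0 z≤n) (η-top C)

    chain : MaxChain u w
    chain = record
      { len    = m + n
      ; v      = nz ∘ expansion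
      ; η      = expansion
      ; lab    = label
      ; v-top  = trans (cong nz η-top-graft) (nz-positive w≥1)
      ; v-bot  = trans (cong nz (trans (expansion-+ n) (pathExpansion-end T))) η′↦u
      ; covers = λ j j<len → let (j≥1 , _) , η≡ = graft-step j j<len in
                   subst (Covers (nz (expansion j)) ∘ nz) (sym η≡) (covers-decAt (expansion j) j≥1)
      ; η-top  = η-top-graft
      ; steps  = λ j j<len → let (j≥1 , leftmost) , η≡ = graft-step j j<len in j≥1 , η≡ , refl , leftmost
      }

  relabel-tail : (C : MaxChain u w) → ∀ {j η} → j ≤ len C → nz η ≡ v C j →
    ∃₂ λ η′ (T : LabelledPath η η′ (len C ∸ j)) →
      nz η′ ≡ u × ∀ k → k ≤ len C ∸ j → nz (pathExpansion T k) ≡ v C (j + k)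
  relabel-tail C {j} {η} j≤len nzη≡vj
    with relabel-sequence (v C ∘ (j +_)) (len C ∸ j) (tail-covers C j≤len) η
           (trans nzη≡vj (cong (v C) (sym (+-identityʳ j))))
  ... | η′ , T , T≡ = η′ , T , η′↦u , T≡
    where
    η′↦u : nz η′ ≡ u
    η′↦u = begin
      nz η′                              ≡⟨ cong nz (pathExpansion-end T) ⟨
      nz (pathExpansion T (len C ∸ j))   ≡⟨ T≡ (len C ∸ j) ≤-refl ⟩
      v C (j + (len C ∸ j))              ≡⟨ cong (v C) (m+[n∸m]≡n j≤len) ⟩
      v C (len C)                        ≡⟨ v-bot C ⟩
      u                                  ∎
      where open ≡-Reasoning

  -- Leave C at v_i by a smaller label, descend to v_j, then follow C again.
  skipped-by-detour : (C : MaxChain u w) → ∀ {i j l} → suc (suc i) ≤ j → j ≤ len C →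
    ValidLabel (η C i) l → l < lab C i → v C j ≼ nz (decAt l (η C i)) → Skipped C i j
  skipped-by-detour C {i} {j} {l} i+2≤j j≤len valid l<lab vj≼
    with relabel-path (≼⇒CoverPath (v-positive C j j≤len) (positive-nz (decAt l (η C i))) vj≼)
                      (decAt l (η C i)) refl
  ... | η* , d , D , nzη*≡vj with relabel-tail C j≤len nzη*≡vj
  ... | η′ , T , η′↦u , T≡ = i+2≤j , j≤len , G.chain , G<C , kept
    where
    i<len = <-≤-trans (≤-trans (n≤1+n (suc i)) i+2≤j) j≤len
    module G = Graft C (<⇒≤ i<len) (step l valid (D ++ᴸ T)) η′↦u

    G<C : G.chain <ₗₑₓ C
    G<C = i , G.label-< , inj₁ (m<m+n i z<s , i<len , subst (_< lab C i) (sym label-i) l<lab)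
      where
      label-i : G.label i ≡ l
      label-i = trans (cong G.label (sym (+-identityʳ i))) (G.label-+ 0)

    kept : ∀ k → k ≤ len C → k ≤ i ⊎ j ≤ k → v C k ∈C G.chain
    kept k k≤len (inj₁ k≤i) =
      k , ≤-trans k≤i (m≤m+n i _) , trans (cong nz (G.expansion-≤ k k≤i)) (sym (v≡nz-η C k k≤len))
    kept k k≤len (inj₂ j≤k) =
      i + suc (d + (k ∸ j)) , +-monoʳ-≤ i (s≤s (+-monoʳ-≤ d (∸-monoˡ-≤ j k≤len))) , (begin
      nz (G.expansion (i + suc (d + (k ∸ j))))     ≡⟨ cong nz (G.expansion-+ _) ⟩
      nz (pathExpansion (D ++ᴸ T) (d + (k ∸ j)))   ≡⟨ cong nz (pathExpansion-++ʳ D T (k ∸ j)) ⟩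
      nz (pathExpansion T (k ∸ j))                 ≡⟨ T≡ (k ∸ j) (∸-monoˡ-≤ j k≤len) ⟩
      v C (j + (k ∸ j))                            ≡⟨ cong (v C) (m+[n∸m]≡n j≤k) ⟩
      v C k                                        ∎)
      where open ≡-Reasoning

  lex-divergence : (C C′ : MaxChain u w) → ∀ {i j} → j ≤ len C → C′ <ₗₑₓ C →
    (∀ k → k ≤ len C → k ≤ i ⊎ j ≤ k → v C k ∈C C′) →
    ∃ λ m → i ≤ m × Skipped C m j × m < len C′ × η C′ m ≡ η C m × lab C′ m < lab C m
  lex-divergence C C′ _ (m , _ , inj₂ (m≡len′ , m<len)) _ =
    ⊥-elim (<-irrefl (trans m≡len′ (len-unique C C′)) m<len)
  lex-divergence C C′ {i} {j} j≤len C′<C@(m , agree , inj₁ (m<len′ , m<len , lab<)) kept =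
    m , i≤m , (m+2≤j , j≤len , C′ , C′<C , kept′) , m<len′ , η≡ , lab<
    where
    η≡ : η C′ m ≡ η C m
    η≡ = η-agree C C′ m agree (<⇒≤ m<len) (<⇒≤ m<len′)

    -- the label of a step is determined by its endpoints
    next-missed : ¬ (v C (suc m) ∈C C′)
    next-missed (k′ , k′≤len′ , v≡) with index-unique C C′ v≡ k′≤len′ m<len
    ... | refl = <-irrefl (LabelStep-unique step′ (steps C m m<len)) lab<
      where
      step′ : LabelStep (η C m) (v C (suc m)) (lab C′ m) (η C′ (suc m))
      step′ = subst₂ (λ ξ y → LabelStep ξ y (lab C′ m) (η C′ (suc m))) η≡ v≡ (steps C′ m m<len′)

    i≤m : i ≤ m
    i≤m with suc m ≤? i
    ... | yes 1+m≤i = ⊥-elim (next-missed (kept (suc m) m<len (inj₁ 1+m≤i)))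
    ... | no  1+m≰i = s≤s⁻¹ (≰⇒> 1+m≰i)

    m+2≤j : suc (suc m) ≤ j
    m+2≤j with j ≤? suc m
    ... | yes j≤1+m = ⊥-elim (next-missed (kept (suc m) m<len (inj₂ j≤1+m)))
    ... | no  j≰1+m = ≰⇒> j≰1+m

    kept′ : ∀ k → k ≤ len C → k ≤ m ⊎ j ≤ k → v C k ∈C C′
    kept′ k k≤len (inj₁ k≤m) = k , k≤len′ , (begin
      v C′ k       ≡⟨ v≡nz-η C′ k k≤len′ ⟩
      nz (η C′ k)  ≡⟨ cong nz (η-agree C C′ k (λ k₁ k₁<k → agree k₁ (<-≤-trans k₁<k k≤m)) k≤len k≤len′) ⟩
      nz (η C k)   ≡⟨ v≡nz-η C k k≤len ⟨
      v C k        ∎)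
      where
      open ≡-Reasoning
      k≤len′ = ≤-trans k≤m (<⇒≤ m<len′)
    kept′ k k≤len (inj₂ j≤k) = kept k k≤len (inj₂ j≤k)

  MSI-detour : (C : MaxChain u w) → ∀ {i j} → MSI C i j →
    ∃ λ l → ValidLabel (η C i) l × l < lab C i × v C j ≼ nz (decAt l (η C i))
  MSI-detour C {i} {j} ((i+2≤j , j≤len , C′ , C′<C , kept) , minimal)
    with lex-divergence C C′ j≤len C′<C kept
  ... | m , i≤m , skipped , m<len′ , η≡ , lab< with minimal m j skipped i≤m ≤-refl
  ... | refl , _ = lab C′ i , valid , lab< , subst₂ _≼_ vj≡ v₁≡ (v-antitone C′ (<⇒≤ i+2≤j) j≤len′)
    where
    valid : ValidLabel (η C i) (lab C′ i)
    valid = subst (λ ξ → ValidLabel ξ (lab C′ i)) η≡ (label-valid C′ i m<len′)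
    j≤len′ = subst (j ≤_) (sym (len-unique C C′)) j≤len
    vj≡ : v C′ j ≡ v C j
    vj≡ with kept j j≤len (inj₂ ≤-refl)
    ... | k′ , k′≤len′ , v≡ with index-unique C C′ v≡ k′≤len′ j≤len
    ...   | refl = v≡
    v₁≡ : v C′ (suc i) ≡ nz (decAt (lab C′ i) (η C i))
    v₁≡ = trans (v≡nz-η C′ (suc i) m<len′)
                (cong nz (trans (η-step C′ i m<len′) (cong (decAt (lab C′ i)) η≡)))

  descent⇒skipped : (C : MaxChain u w) → ∀ k → suc (suc k) ≤ len C → lab C (suc k) < lab C k →
    Skipped C k (suc (suc k))
  descent⇒skipped C k k+2≤len descent = skipped-by-detour C ≤-refl k+2≤len valid descent
    (subst (_≼ nz (decAt l₁ (η C k))) (sym v₂≡) (nz-decAt-≼ (decAt l₁ (η C k)) l₀))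
    where
    k<len = ≤-trans (n≤1+n (suc k)) k+2≤len
    l₀ = lab C k
    l₁ = lab C (suc k)
    η₁≡ : η C (suc k) ≡ decAt l₀ (η C k)
    η₁≡ = η-step C k k<len
    below : ∀ q → q ≤ l₁ → at (η C (suc k)) q ≡ at (η C k) q
    below q q≤l₁ = trans (cong (λ ξ → at ξ q) η₁≡)
      (at-decAt-other (η C k) λ l₀≡q → <⇒≱ descent (subst (_≤ l₁) (sym l₀≡q) q≤l₁))
    valid : ValidLabel (η C k) l₁
    valid = ValidLabel-transfer (η C (suc k)) (η C k) below (label-valid C (suc k) k+2≤len)
    v₂≡ : v C (suc (suc k)) ≡ nz (decAt l₀ (decAt l₁ (η C k)))
    v₂≡ = begin
      v C (suc (suc k))                    ≡⟨ v≡nz-η C (suc (suc k)) k+2≤len ⟩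
      nz (η C (suc (suc k)))               ≡⟨ cong nz (η-step C (suc k) k+2≤len) ⟩
      nz (decAt l₁ (η C (suc k)))          ≡⟨ cong (nz ∘ decAt l₁) η₁≡ ⟩
      nz (decAt l₁ (decAt l₀ (η C k)))     ≡⟨ cong nz (decAt-comm (η C k) (<⇒≢ descent)) ⟩
      nz (decAt l₀ (decAt l₁ (η C k)))     ∎
      where open ≡-Reasoning

-- Weakly decreasing chains

module _ {u w : Word} (C : MaxChain u w) (wd : WeaklyDecreasing C) where

  first-label : ∀ {p} → at (endsAt C) p < at w p →
    ∃ λ s → s < len C × lab C s ≡ p × (∀ k → k < s → p < lab C k)
  first-label {p} decreased with first-witness (λ k → lab C k ≟ p) (len C)
  ... | inj₁ absent = ⊥-elim (<-irrefl unchanged decreased)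
    where
    unchanged : at (endsAt C) p ≡ at w p
    unchanged = trans (at-η-untouched C z≤n ≤-refl (λ k _ → absent k)) (cong (λ ξ → at ξ p) (η-top C))
  ... | inj₂ (s , s<len , labs , before) = s , s<len , labs , above
    where
    above : ∀ k → k < s → p < lab C k
    above k k<s = ≤∧≢⇒< (subst (_≤ lab C k) labs (label-antitone C wd (<⇒≤ k<s) s<len))
                         (λ p≡lab → before k k<s (sym p≡lab))

  -- If the step at s were the last one using label p, the entry at p
  -- would end one below its value at s.
  label-repeats : ∀ {s p} → s < len C → lab C s ≡ p → at (endsAt C) p + 2 ≤ at (η C s) p →
    suc s < len C × lab C (suc s) ≡ p
  label-repeats {s} {p} s<len labs steep = 1+s<len , lab₁≡p
    where
    η₁p≡ : at (η C (suc s)) p ≡ pred (at (η C s) p)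
    η₁p≡ = begin
      at (η C (suc s)) p                ≡⟨ cong (λ ξ → at ξ p) (η-step C s s<len) ⟩
      at (decAt (lab C s) (η C s)) p    ≡⟨ cong (λ l → at (decAt l (η C s)) p) labs ⟩
      at (decAt p (η C s)) p            ≡⟨ at-decAt-self (η C s) p ⟩
      pred (at (η C s) p)               ∎
      where open ≡-Reasoning
    not-final : at (endsAt C) p ≢ at (η C (suc s)) p
    not-final final =
      pred+2≰ (at (η C s) p) (subst (λ x → x + 2 ≤ at (η C s) p) (trans final η₁p≡) steep)
    1+s<len : suc s < len C
    1+s<len with m≤n⇒m<n∨m≡n s<len
    ... | inj₁ 1+s<len = 1+s<len
    ... | inj₂ 1+s≡len = ⊥-elim (not-final (cong (λ k → at (η C k) p) (sym 1+s≡len)))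
    lab₁≡p : lab C (suc s) ≡ p
    lab₁≡p with lab C (suc s) ≟ p
    ... | yes lab₁≡p = lab₁≡p
    ... | no  lab₁≢p = ⊥-elim (not-final (at-η-untouched C (<⇒≤ 1+s<len) ≤-refl below-p))
      where
      lab₁<p : lab C (suc s) < p
      lab₁<p = ≤∧≢⇒< (subst (lab C (suc s) ≤_) labs (wd s 1+s<len)) lab₁≢p
      below-p : ∀ k → suc s ≤ k → k < len C → lab C k ≢ p
      below-p k 1+s≤k k<len labk≡p =
        <⇒≱ lab₁<p (subst (_≤ lab C (suc s)) labk≡p (label-antitone C wd 1+s≤k k<len))

  run-of-ones-interior : ∀ {r t i} → Run w 1 r t → r < i → i ≤ t → at (endsAt C) i ≢ 0
  run-of-ones-interior {i = suc i} (_ , _ , ones , _ , _) r<1+i 1+i≤t ηi≡0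
    with first-label (subst₂ _<_ (sym ηi≡0) (sym (ones (suc i) (<⇒≤ r<1+i) 1+i≤t)) z<s)
  ... | s , s<len , labs , above = LeftmostOne-after-one (η C s) ηs-before≡1 leftmost
    where
    fresh = at-η-unchanged C (<⇒≤ s<len) above
    ηs-before≡1 : at (η C s) i ≡ 1
    ηs-before≡1 = trans (fresh i (n≤1+n i)) (ones i (s≤s⁻¹ r<1+i) (≤-trans (n≤1+n i) 1+i≤t))
    ηs-at≡1 : at (η C s) (lab C s) ≡ 1
    ηs-at≡1 = trans (cong (at (η C s)) labs)
                    (trans (fresh (suc i) ≤-refl) (ones (suc i) (<⇒≤ r<1+i) 1+i≤t))
    leftmost : LeftmostOne (η C s) (suc i)
    leftmost = subst (LeftmostOne (η C s)) labs (proj₂ (label-valid C s s<len) ηs-at≡1)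

module _ {u w : Word} (w≥1 : Positive w) (C : MaxChain u w) (wd : WeaklyDecreasing C) where

  MSI-constant-labels : ∀ {i j s} → MSI C i j → i ≤ s → suc s < j → lab C (suc s) ≡ lab C s →
    ∀ k → i ≤ k → k < j → lab C k ≡ lab C i
  MSI-constant-labels {i} {j} {s} (skipped , minimal) i≤s 1+s<j repeat = constant
    where
    j≤len = proj₁ (proj₂ skipped)

    -- a descent is itself a skipped interval, so it would be the whole MSI
    no-descent : ∀ k → i ≤ k → suc (suc k) ≤ j → ¬ lab C (suc k) < lab C k
    no-descent k i≤k k+2≤j descent
      with minimal k (suc (suc k)) (descent⇒skipped w≥1 C k (≤-trans k+2≤j j≤len) descent) i≤k k+2≤j
    ... | refl , refl = <-irrefl repeat′ descent
      where
      repeat′ : lab C (suc k) ≡ lab C k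
      repeat′ = subst (λ z → lab C (suc z) ≡ lab C z) (≤-antisym (s≤s⁻¹ (s≤s⁻¹ 1+s<j)) i≤s) repeat

    constant : ∀ k → i ≤ k → k < j → lab C k ≡ lab C i
    constant zero    i≤0   _     = cong (lab C) (sym (n≤0⇒n≡0 i≤0))
    constant (suc k) i≤1+k 1+k<j with i ≤? k
    ... | no  i≰k = cong (lab C) (sym (≤-antisym i≤1+k (≰⇒> i≰k)))
    ... | yes i≤k = trans (≤-antisym (wd k (<-≤-trans 1+k<j j≤len)) (≮⇒≥ (no-descent k i≤k 1+k<j)))
                          (constant k i≤k (<-trans (n<1+n k) 1+k<j))

  MSI-at-repeat : Critical C → ∀ {s p} → suc s < len C → lab C s ≡ p → lab C (suc s) ≡ p →
    (∀ k → k < s → p < lab C k) → ∃ λ j → MSI C s j × suc s < j × (∀ k → s ≤ k → k < j → lab C k ≡ p)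
  MSI-at-repeat critical {s} {p} 1+s<len labs lab₁ above
    with critical⇒inside-MSI C critical (suc s) z<s 1+s<len
  ... | i , j , msi , i<1+s , 1+s<j = j , subst (λ i → MSI C i j) i≡s msi , 1+s<j , labels
    where
    i≤s = s≤s⁻¹ i<1+s
    constant = MSI-constant-labels msi i≤s 1+s<j (trans lab₁ (sym labs))
    labi≡p : lab C i ≡ p
    labi≡p = trans (sym (constant s i≤s (<-trans (n<1+n s) 1+s<j))) labs
    i≡s : i ≡ s
    i≡s with m≤n⇒m<n∨m≡n i≤s
    ... | inj₁ i<s = ⊥-elim (<-irrefl (sym labi≡p) (above i i<s))
    ... | inj₂ i≡s = i≡s
    labels : ∀ k → s ≤ k → k < j → lab C k ≡ p
    labels k s≤k k<j = trans (constant k (≤-trans i≤s s≤k) k<j) labi≡p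

-- An MSI C(v_s, v_j) whose steps all carry the label p, where η_s still
-- agrees with w up to p.  A chain skipping it leaves v_s by a label l < p, so
-- v_j must embed into Y ++ a ∷ Q with Y lighter than the part P of η_s left
-- of p.  This forces the block to use up the entry a = w(p), and minimality
-- of the MSI then forces w(p − 1) = w(p).
module RepeatedLabel {u w : Word} (w≥1 : Positive w) (C : MaxChain u w) {s j p : ℕ}
  (msi : MSI C s j) (1+s<j : suc s < j) (p<w : p < length w)
  (labels : ∀ k → s ≤ k → k < j → lab C k ≡ p)
  (fresh : ∀ q → q ≤ p → at (η C s) q ≡ at w q) where

  j≤len : j ≤ len C
  j≤len = proj₁ (proj₂ (proj₁ msi))

  s<j : s < j
  s<j = <-trans (n<1+n s) 1+s<j

  a t : ℕ
  a = at w p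
  t = j ∸ s

  s+t≡j : s + t ≡ j
  s+t≡j = m+[n∸m]≡n (<⇒≤ s<j)

  P R : List ℕ
  P = List.take p (η C s)
  R = List.drop (suc p) (η C s)

  p<ηs : p < length (η C s)
  p<ηs = subst (p <_) (sym (length-η C s (≤-trans (<⇒≤ s<j) j≤len))) p<w

  P-length : length P ≡ p
  P-length = trans (length-take p (η C s)) (m≤n⇒m⊓n≡m (<⇒≤ p<ηs))

  P-at : ∀ {q} → q < p → at P q ≡ at w q
  P-at q<p = trans (at-take (η C s) q<p) (fresh _ (<⇒≤ q<p))

  at-prefix : ∀ {x q} → q < p → at (P ++ x ∷ R) q ≡ at w q
  at-prefix q<p = trans (at-++ˡ P _ (subst (_ <_) (sym P-length) q<p)) (P-at q<p)

  P-positive : Positive P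
  P-positive = positive-from-at P λ q q<P → let q<p = subst (q <_) P-length q<P in
    subst (1 ≤_) (sym (P-at q<p)) (at-positive w≥1 (<-trans q<p p<w))

  η-block : ∀ n → n ≤ t → η C (s + n) ≡ P ++ (a ∸ n) ∷ R
  η-block n n≤t = trans (η-repeated-label C (subst (_≤ len C) (sym s+t≡j) j≤len) labels′ p<ηs n n≤t)
                        (cong (λ x → P ++ (x ∸ n) ∷ R) (fresh p ≤-refl))
    where
    labels′ : ∀ k → s ≤ k → k < s + t → lab C k ≡ p
    labels′ k s≤k k<s+t = labels k s≤k (subst (k <_) s+t≡j k<s+t)

  at-block : ∀ n → n ≤ t → at (η C (s + n)) p ≡ a ∸ n
  at-block n n≤t = trans (cong (λ ξ → at ξ p) (η-block n n≤t))
    (subst (λ q → at (P ++ (a ∸ n) ∷ R) q ≡ a ∸ n) P-length (at-++-length P (a ∸ n) R))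

  detour : ∃ λ l → ValidLabel (η C s) l × l < lab C s × v C j ≼ nz (decAt l (η C s))
  detour = MSI-detour w≥1 C msi

  l : ℕ
  l = proj₁ detour

  l<p : l < p
  l<p = subst (l <_) (labels s ≤-refl s<j) (proj₁ (proj₂ (proj₂ detour)))

  l<P : l < length P
  l<P = subst (l <_) (sym P-length) l<p

  Y Q : Word
  Y = nz (decAt l P)
  Q = nz R

  Y-lighter : sum Y < sum P
  Y-lighter = ≤-reflexive (trans (cong suc (sum-nz (decAt l P)))
    (sum-decAt P l (subst (1 ≤_) (sym (P-at l<p)) (at-positive w≥1 (<-trans l<p p<w)))))

  v-j : v C j ≡ P ++ nz ((a ∸ t) ∷ R)
  v-j = begin
    v C j                     ≡⟨ v≡nz-η w≥1 C j j≤len ⟩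
    nz (η C j)                ≡⟨ cong (nz ∘ η C) s+t≡j ⟨
    nz (η C (s + t))          ≡⟨ cong nz (η-block t ≤-refl) ⟩
    nz (P ++ (a ∸ t) ∷ R)     ≡⟨ nz-++ P _ ⟩
    nz P ++ nz ((a ∸ t) ∷ R)  ≡⟨ cong (_++ nz ((a ∸ t) ∷ R)) (nz-positive P-positive) ⟩
    P ++ nz ((a ∸ t) ∷ R)     ∎
    where open ≡-Reasoning

  v-j≼ : P ++ nz ((a ∸ t) ∷ R) ≼ Y ++ a ∷ Q
  v-j≼ = subst₂ _≼_ v-j detour-top (proj₂ (proj₂ (proj₂ detour)))
    where
    detour-top : nz (decAt l (η C s)) ≡ Y ++ a ∷ Q
    detour-top = trans (cong (nz ∘ decAt l) (trans (cong (η C) (sym (+-identityʳ s))) (η-block 0 z≤n)))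
                       (nz-decAt-prefix P R l<P (at-positive w≥1 p<w))

  exhausted : a ∸ t ≡ 0
  exhausted with a ∸ t in a∸t≡
  ... | zero  = refl
  ... | suc b =
    ⊥-elim (heavy-prefix-≼-last Y-lighter (subst (λ x → P ++ nz (x ∷ R) ≼ Y ++ a ∷ Q) a∸t≡ v-j≼))

  a≤t : a ≤ t
  a≤t = m∸n≡0⇒m≤n exhausted

  0<p : 0 < p
  0<p = ≤-<-trans z≤n l<p

  c : ℕ
  c = at w (pred p)

  pred-p<p : pred p < p
  pred-p<p = subst (pred p <_) (suc-pred p ⦃ >-nonZero 0<p ⦄) (n<1+n (pred p))

  -- The last step of the block turns the entry at p from 1 into 0, so it
  -- must be the leftmost 1 of its run; hence w(p − 1) ≠ 1.
  c≢1 : c ≢ 1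
  c≢1 c≡1 = LeftmostOne-after-one (η C k₀) (trans (at-block-prefix (t ∸ 1) (m∸n≤m t 1) pred-p<p) c≡1)
    (subst (LeftmostOne (η C k₀)) (sym (suc-pred p ⦃ >-nonZero 0<p ⦄)) leftmost)
    where
    1+t′≡t : suc (t ∸ 1) ≡ t
    1+t′≡t = m+[n∸m]≡n (≤-trans (at-positive w≥1 p<w) a≤t)
    k₀ = s + (t ∸ 1)
    k₀<j : k₀ < j
    k₀<j = subst (k₀ <_) s+t≡j (+-monoʳ-< s (subst (t ∸ 1 <_) 1+t′≡t (n<1+n (t ∸ 1))))
    at-block-prefix : ∀ n → n ≤ t → ∀ {q} → q < p → at (η C (s + n)) q ≡ at w q
    at-block-prefix n n≤t q<p = trans (cong (λ ξ → at ξ _) (η-block n n≤t)) (at-prefix q<p)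
    valid : ValidLabel (η C k₀) p
    valid = subst (ValidLabel (η C k₀)) (labels k₀ (m≤m+n s _) k₀<j)
                  (label-valid C k₀ (<-≤-trans k₀<j j≤len))
    entry≡1 : at (η C k₀) p ≡ 1
    entry≡1 = pred≡0⇒≡1 (proj₁ valid) (begin
      pred (at (η C k₀) p)  ≡⟨ cong pred (at-block (t ∸ 1) (m∸n≤m t 1)) ⟩
      pred (a ∸ (t ∸ 1))    ≡⟨ pred[m∸n]≡m∸[1+n] a (t ∸ 1) ⟩
      a ∸ suc (t ∸ 1)       ≡⟨ cong (a ∸_) 1+t′≡t ⟩
      a ∸ t                 ≡⟨ exhausted ⟩
      0                     ∎)
      where open ≡-Reasoning
    leftmost : LeftmostOne (η C k₀) p
    leftmost = proj₂ valid entry≡1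

  P-split : ∃₂ λ X₀ x → P ≡ X₀ ++ [ x ] × X₀ ≼ Y × x ≤ a
  P-split = heavy-prefix-≼⁻ P Y Q a (subst (λ x → P ++ nz (x ∷ R) ≼ Y ++ a ∷ Q) exhausted v-j≼) Y-lighter

  2≤c : 2 ≤ c
  2≤c = ≤∧≢⇒< (at-positive w≥1 (<-trans pred-p<p p<w)) (c≢1 ∘ sym)

  last-of-P : ∀ {X₀ x} → P ≡ X₀ ++ [ x ] → x ≡ c
  last-of-P {X₀} {x} P≡ = begin
    x                            ≡⟨ at-++-length X₀ x [] ⟨
    at (X₀ ++ [ x ]) (length X₀) ≡⟨ cong₂ at (sym P≡) (cong pred 1+X₀≡p) ⟩
    at P (pred p)                ≡⟨ P-at pred-p<p ⟩
    c                            ∎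
    where
    open ≡-Reasoning
    1+X₀≡p : suc (length X₀) ≡ p
    1+X₀≡p = trans (sym (trans (length-++ X₀) (+-comm (length X₀) 1)))
                   (trans (cong length (sym P≡)) P-length)

  -- When w(p − 1) < a, v_j already lies below the detour from v_(s+1) by l.
  shortcut : ∀ {X₀ x} → P ≡ X₀ ++ [ x ] → X₀ ≼ Y → 2 ≤ x → x < a → Skipped C (suc s) j
  shortcut {X₀} {x} P≡ X₀≼Y 2≤x x<a = skipped-by-detour w≥1 C s+3≤j j≤len valid₁ l<lab₁
    (subst₂ _≼_ (sym v-j≡) (sym detour-top₁) (≼-++ X₀≼Y (take (<⇒≤pred x<a) ≼-refl)))
    where
    2≤a : 2 ≤ a
    2≤a = <⇒≤ (≤-<-trans 2≤x x<a)
    s+3≤j : suc (suc (suc s)) ≤ j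
    s+3≤j = subst₂ _≤_ (+-comm s 3) s+t≡j (+-monoʳ-≤ s (≤-trans (≤-<-trans 2≤x x<a) a≤t))
    η₁≡ : η C (suc s) ≡ P ++ (a ∸ 1) ∷ R
    η₁≡ = trans (cong (η C) (+-comm 1 s)) (η-block 1 (≤-trans (≤-trans (s≤s z≤n) 2≤a) a≤t))
    valid₁ : ValidLabel (η C (suc s)) l
    valid₁ = ValidLabel-transfer (η C s) (η C (suc s)) agree (proj₁ (proj₂ detour))
      where
      agree : ∀ q → q ≤ l → at (η C s) q ≡ at (η C (suc s)) q
      agree q q≤l = trans (fresh q (≤-trans q≤l (<⇒≤ l<p)))
        (sym (trans (cong (λ ξ → at ξ q) η₁≡) (at-prefix (≤-<-trans q≤l l<p))))
    l<lab₁ : l < lab C (suc s)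
    l<lab₁ = subst (l <_) (sym (labels (suc s) (n≤1+n s) 1+s<j)) l<p
    v-j≡ : v C j ≡ X₀ ++ x ∷ Q
    v-j≡ = begin
      v C j                  ≡⟨ v-j ⟩
      P ++ nz ((a ∸ t) ∷ R)  ≡⟨ cong (λ y → P ++ nz (y ∷ R)) exhausted ⟩
      P ++ Q                 ≡⟨ cong (_++ Q) P≡ ⟩
      (X₀ ++ [ x ]) ++ Q     ≡⟨ ++-assoc X₀ [ x ] Q ⟩
      X₀ ++ x ∷ Q            ∎
      where open ≡-Reasoning
    detour-top₁ : nz (decAt l (η C (suc s))) ≡ Y ++ (a ∸ 1) ∷ Q
    detour-top₁ = trans (cong (nz ∘ decAt l) η₁≡) (nz-decAt-prefix P R l<P (∸-monoˡ-≤ 1 2≤a))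

  -- The shortcut would be a skipped interval strictly inside the MSI.
  c≡a : c ≡ a
  c≡a with c ≟ a | P-split
  ... | yes c≡a | _ = c≡a
  ... | no  c≢a | X₀ , x , P≡ , X₀≼Y , x≤a =
    ⊥-elim (<⇒≢ (n<1+n s) (proj₁ (proj₂ msi (suc s) j (shortcut P≡ X₀≼Y 2≤x x<a) (n≤1+n s) ≤-refl)))
    where
    2≤x = subst (2 ≤_) (sym (last-of-P P≡)) 2≤c
    x<a = ≤∧≢⇒< x≤a (c≢a ∘ trans (sym (last-of-P P≡)))

  continues-run : at (η C j) p ≡ 0 × 0 < p × at w (pred p) ≡ at w p
  continues-run =
    trans (cong (λ k → at (η C k) p) (sym s+t≡j)) (trans (at-block t ≤-refl) exhausted) , 0<p , c≡a

-- Normality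

RunStart : Word → ℕ → Set
RunStart w p = p ≡ 0 ⊎ at w (pred p) ≢ at w p

module _ {u w : Word} (w≥1 : Positive w) (C : MaxChain u w) (wd : WeaklyDecreasing C)
         (critical : Critical C) where

  steep-drop-impossible : ∀ {p} → p < length w → at (endsAt C) p + 2 ≤ at w p →
    1 ≤ at (endsAt C) p ⊎ RunStart w p → ⊥
  steep-drop-impossible {p} p<w steep start with first-label C wd (<-≤-trans (m<m+n _ z<s) steep)
  ... | s , s<len , labs , above
    with label-repeats C wd s<len labs
           (subst (λ x → _ + 2 ≤ x) (sym (at-η-unchanged C (<⇒≤ s<len) above p ≤-refl)) steep)
  ... | 1+s<len , lab₁ with MSI-at-repeat w≥1 C wd critical 1+s<len labs lab₁ above
  ... | j , msi , 1+s<j , labels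
    with RepeatedLabel.continues-run w≥1 C msi 1+s<j p<w labels (at-η-unchanged C (<⇒≤ s<len) above)
  ... | ηj≡0 , 0<p , continues = refute start
    where
    refute : 1 ≤ at (endsAt C) p ⊎ RunStart w p → ⊥
    refute (inj₁ ended≥1)       = 1+n≰n (≤-trans ended≥1
      (subst (at (endsAt C) p ≤_) ηj≡0 (at-η-antitone C p (proj₁ (proj₂ (proj₁ msi))) ≤-refl)))
    refute (inj₂ (inj₁ p≡0))    = <⇒≢ 0<p (sym p≡0)
    refute (inj₂ (inj₂ starts)) = starts continues

  normal : Normal w (endsAt C)
  normal = entries , runs
    where
    entries : ∀ i → i < length w → let e = at (endsAt C) i in e ≡ at w i ⊎ e ≡ pred (at w i) ⊎ e ≡ 0
    entries i i<w = near-or-zero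
      (subst (at (endsAt C) i ≤_) (cong (λ ξ → at ξ i) (η-top C)) (at-η-antitone C i z≤n ≤-refl))
      (λ (ended≥1 , steep) → steep-drop-impossible i<w steep (inj₁ ended≥1))
    runs : ∀ k r t → Run w k r t →
      (k ≡ 1 → ∀ i → r < i → i ≤ t → at (endsAt C) i ≢ 0) × (2 ≤ k → at (endsAt C) r ≢ 0)
    runs k r t run@(r≤t , t<w , all-k , start , _) =
      (λ { refl i → run-of-ones-interior C wd run }) ,
      λ 2≤k ended≡0 → steep-drop-impossible (≤-<-trans r≤t t<w)
        (subst₂ (λ e x → e + 2 ≤ x) (sym ended≡0) (sym w-r≡k) 2≤k)
        (inj₂ (map₂ (λ ≢k → ≢k ∘ flip trans w-r≡k) start))
      where
      w-r≡k : at w r ≡ k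
      w-r≡k = all-k r ≤-refl r≤t

proposition4p6 : (u w : Word) → Positive u → Positive w → u ≼ w
    → (C : MaxChain u w) → WeaklyDecreasing C
    → IsEmbedding u w (endsAt C) → ¬ Normal w (endsAt C)
    → ¬ Critical C
proposition4p6 u w _ w≥1 _ C wd _ not-normal critical = not-normal (normal w≥1 C wd critical)
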